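{- Let $p\ge 7$ be a prime. Then $$\sum_{k=1}^{p-1}\frac{H_k\, H_{k,2}}{k}\equiv -\frac{3}{2}\sum_{k=1}^{p-1}\frac{H_k^2}{k^2}\pmod{p}.$$
   Context: $H_{n,m}=\sum_{k=1}^{n}\frac{1}{k^m}$ and $H_n=H_{n,1}$. Congruences modulo $p$ are taken in the ring of rational numbers with denominators not divisible by $p$. -}

module Defs where

open import Data.Nat as ℕ using (ℕ; zero; suc)
open import Data.Nat.Properties using (m^n≢0)
open import Data.Nat.Divisibility as ℕD using ()
open import Data.Integer as ℤ using (ℤ; +_)
open import Data.Rational using (ℚ; 0ℚ; _+_; _-_; _*_; _/_; ↧ₙ_)
open import Data.Product using (Σ; _×_)
open import Relation.Nullary using (¬_)
open import Relation.Binary.PropositionalEquality using (_≡_)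

-- 1 / (k+1)^m, written with the successor to avoid division by zero
inv-pow : ℕ → ℕ → ℚ
inv-pow k m = _/_ (+ 1) (suc k ℕ.^ m) {{m^n≢0 (suc k) m}}

sumFrom1 : ℕ → (ℕ → ℚ) → ℚ
sumFrom1 zero    f = 0ℚ
sumFrom1 (suc n) f = sumFrom1 n f + f (suc n)

-- H_{n,m} = Σ_{k=1}^{n} 1/k^m
H2 : ℕ → ℕ → ℚ
H2 n m = sumFrom1 n (λ k → inv-pow (k ℕ.∸ 1) m)

H : ℕ → ℚ
H n = H2 n 1

-- 1/k^m for k ≥ 1 (value at k = 0 is irrelevant: only used for k ≥ 1)
invPow : ℕ → ℕ → ℚ
invPow k m = inv-pow (k ℕ.∸ 1) m

pIntegral : ℕ → ℚ → Set
pIntegral p r = ¬ (p ℕD.∣ ↧ₙ r)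

-- x ≡ y (mod p) in the ring Z_(p): x, y p-integral and of p-integral rationals: x - y = p·r, r p-integral
_≡_[modℚ_] : ℚ → ℚ → ℕ → Set
x ≡ y [modℚ p ] =
  pIntegral p x × pIntegral p y × Σ ℚ (λ r → pIntegral p r × (x - y ≡ (+ p / 1) * r))

-- Both sums in fact vanish modulo p.  Write S(a₁,…,aᵣ)(n) for the multiple harmonic
-- star sums.  The stuffle
-- relations, exact identities proved by telescoping, rewrite products of star sums
-- as sums of star sums; in particular Σ H_k H_{k,2}/k = S(1,1,2) + S(1,2,1) − S(1,3)
-- and Σ H_k²/k² = 2 S(2,1,1) − S(2,2).  The reflection k ↦ p − k gives H_{p−1} ≡ 0
-- and 2 S(3,1) ≡ S(4).  The binomial transform ∇F(n) = Σ_k (−1)^(k−1) C(n,k) F(k)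
-- sends k ↦ S(a₂,…)(k)/k^a₁ to the dual star sum, and since (−1)^k C(p−1,k) ≡ 1 we
-- get ∇F(p−1) ≡ −Σ_{k<p} F(k); this yields S(1,1) + S(2), S(1,1,1,1) + S(4),
-- S(1,1,2) + S(3,1) and S(1,2,1) + S(2,2) ≡ 0.  Solving the resulting linear system,
-- dividing by 2, 3 and 5, shows that every star sum involved vanishes mod p.

module Submission where

open import Defs
open import Data.Nat using (ℕ; _≤_; _∸_)
open import Data.Nat.Primality using (Prime)
open import Data.Integer using (+_; -[1+_])
open import Data.Rational using (_+_; _*_; _/_)

open import Data.Empty using (⊥-elim)
import Data.Integer as ℤ
import Data.Integer.Properties as ℤ
open import Data.List using (List; []; _∷_; replicate)
open import Data.Nat as ℕ using (zero; suc; _<_; z≤n; s≤s; NonZero)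
import Data.Nat.Properties as ℕ
open import Data.Nat.Combinatorics using (_C_; nCk+nC[k+1]≡[n+1]C[k+1]; k>n⇒nCk≡0; nC1≡n)
open import Data.Nat.Divisibility using (_∣_; _∤_; divides; ∣-trans; >⇒∤)
open import Data.Nat.Primality using (euclidsLemma)
open import Data.Product using (_,_)
open import Data.Rational using (ℚ; 0ℚ; 1ℚ; -_; _-_; ↧_; ↧ₙ_; toℚᵘ)
import Data.Rational.Properties as ℚ
open import Algebra.Definitions.RawSemiring ℚ.+-*-rawSemiring using (_^_)
open import Data.Rational.Solver using (module +-*-Solver)
open +-*-Solver using (solve; _:=_; _:+_; _:-_; :-_; _:*_; _:^_; con)
import Data.Rational.Unnormalised as ℚᵘ
import Data.Rational.Unnormalised.Properties as ℚᵘ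
open import Data.Sum using ([_,_]; inj₁; inj₂)
open import Function using (_∘_)
open import Relation.Binary.PropositionalEquality
  using (_≡_; refl; sym; trans; cong; cong₂; subst; module ≡-Reasoning)
open import Relation.Nullary.Decidable using (from-yes)

fromℕ : ℕ → ℚ
fromℕ n = + n / 1

inv : ℕ → ℚ
inv k = invPow k 1

toℚᵘ-/ : ∀ i d → toℚᵘ (i / suc d) ℚᵘ.≃ ℚᵘ.mkℚᵘ i d
toℚᵘ-/ i d = ℚ.toℚᵘ-fromℚᵘ (ℚᵘ.mkℚᵘ i d)

/-≡ : ∀ i j m n .{{_ : NonZero m}} .{{_ : NonZero n}} → i ℤ.* + n ≡ j ℤ.* + m → i / m ≡ j / n
/-≡ i j (suc a) (suc b) e = ℚ.toℚᵘ-injective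
  (ℚᵘ.≃-trans (toℚᵘ-/ i a) (ℚᵘ.≃-trans (ℚᵘ.*≡* e) (ℚᵘ.≃-sym (toℚᵘ-/ j b))))

/-* : ∀ i j m n .{{_ : NonZero m}} .{{_ : NonZero n}} →
      (i / m) * (j / n) ≡ ((i ℤ.* j) / (m ℕ.* n)) {{ℕ.m*n≢0 m n}}
/-* i j (suc a) (suc b) = ℚ.toℚᵘ-injective (ℚᵘ.≃-trans (ℚ.toℚᵘ-homo-* (i / suc a) (j / suc b))
  (ℚᵘ.≃-trans (ℚᵘ.*-cong (toℚᵘ-/ i a) (toℚᵘ-/ j b)) (ℚᵘ.≃-sym (toℚᵘ-/ (i ℤ.* j) _))))

/-+ : ∀ i j → (i / 1) + (j / 1) ≡ (i ℤ.+ j) / 1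
/-+ i j = ℚ.toℚᵘ-injective (ℚᵘ.≃-trans (ℚ.toℚᵘ-homo-+ (i / 1) (j / 1))
  (ℚᵘ.≃-trans (ℚᵘ.+-cong (toℚᵘ-/ i 0) (toℚᵘ-/ j 0))
    (ℚᵘ.≃-trans (ℚᵘ.*≡* (cong (ℤ._* + 1) (cong₂ ℤ._+_ (ℤ.*-identityʳ i) (ℤ.*-identityʳ j))))
      (ℚᵘ.≃-sym (toℚᵘ-/ (i ℤ.+ j) 0)))))

fromℕ-+ : ∀ m n → fromℕ (m ℕ.+ n) ≡ fromℕ m + fromℕ n
fromℕ-+ m n = sym (trans (/-+ (+ m) (+ n)) (cong (_/ 1) (sym (ℤ.pos-+ m n))))

fromℕ-* : ∀ m n → fromℕ (m ℕ.* n) ≡ fromℕ m * fromℕ n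
fromℕ-* m n = sym (trans (/-* (+ m) (+ n) 1 1) (cong (_/ 1) (sym (ℤ.pos-* m n))))

fromℕ*inv : ∀ k → fromℕ (suc k) * inv (suc k) ≡ 1ℚ
fromℕ*inv k = trans (/-* (+ suc k) (+ 1) 1 (suc k ℕ.^ 1))
  (/-≡ (+ suc k ℤ.* + 1) (+ 1) (1 ℕ.* suc k ℕ.^ 1) 1 {{ℕ.m*n≢0 1 (suc k ℕ.^ 1)}} eq)
  where
  eq : (+ suc k ℤ.* + 1) ℤ.* + 1 ≡ + 1 ℤ.* + (1 ℕ.* suc k ℕ.^ 1)
  eq = trans (ℤ.*-identityʳ (+ suc k ℤ.* + 1)) (trans (ℤ.*-identityʳ (+ suc k)) (sym
         (trans (ℤ.*-identityˡ (+ (1 ℕ.* suc k ℕ.^ 1)))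
           (cong +_ (trans (ℕ.*-identityˡ (suc k ℕ.^ 1)) (ℕ.*-identityʳ (suc k)))))))

fromℕ*inv′ : ∀ {k} → 0 < k → fromℕ k * inv k ≡ 1ℚ
fromℕ*inv′ {suc k} _ = fromℕ*inv k

*fromℕ*inv : ∀ x k → x * fromℕ (suc k) * inv (suc k) ≡ x
*fromℕ*inv x k = trans (ℚ.*-assoc x (fromℕ (suc k)) (inv (suc k)))
  (trans (cong (x *_) (fromℕ*inv k)) (ℚ.*-identityʳ x))

invPow-suc : ∀ k m → invPow k (suc m) ≡ inv k * invPow k m
invPow-suc k m = sym (trans (/-* (+ 1) (+ 1) (x ℕ.^ 1) (x ℕ.^ m) {{ℕ.m^n≢0 x 1}} {{ℕ.m^n≢0 x m}})
  (/-≡ (+ 1) (+ 1) _ _ {{ℕ.m*n≢0 (x ℕ.^ 1) (x ℕ.^ m) {{ℕ.m^n≢0 x 1}} {{ℕ.m^n≢0 x m}}}} {{ℕ.m^n≢0 x (suc m)}} eq))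
  where
  x = suc (k ∸ 1)
  eq : + 1 ℤ.* + (x ℕ.^ suc m) ≡ + 1 ℤ.* + (x ℕ.^ 1 ℕ.* x ℕ.^ m)
  eq = cong (λ t → + 1 ℤ.* + (t ℕ.* x ℕ.^ m)) (sym (ℕ.*-identityʳ x))

invPow≡inv^ : ∀ k m → invPow k m ≡ inv k ^ m
invPow≡inv^ k zero = refl
invPow≡inv^ k (suc m) = trans (invPow-suc k m) (cong (inv k *_) (invPow≡inv^ k m))

*inv^-cancel : ∀ x a k → x * inv (suc k) ^ suc a * fromℕ (suc k) ≡ x * inv (suc k) ^ a
*inv^-cancel x a k = trans
  (solve 4 (λ x i y m → x :* (i :* y) :* m := x :* y :* m :* i) refl x (inv (suc k)) (inv (suc k) ^ a) (fromℕ (suc k)))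
  (*fromℕ*inv (x * inv (suc k) ^ a) k)

sum-cong : ∀ n {f g : ℕ → ℚ} → (∀ k → f (suc k) ≡ g (suc k)) → sumFrom1 n f ≡ sumFrom1 n g
sum-cong zero    f≗g = refl
sum-cong (suc n) f≗g = cong₂ _+_ (sum-cong n f≗g) (f≗g n)

sum-+ : ∀ n (f g : ℕ → ℚ) → sumFrom1 n (λ k → f k + g k) ≡ sumFrom1 n f + sumFrom1 n g
sum-+ zero    f g = refl
sum-+ (suc n) f g = trans (cong (_+ (f (suc n) + g (suc n))) (sum-+ n f g))
  (solve 4 (λ F G x y → (F :+ G) :+ (x :+ y) := (F :+ x) :+ (G :+ y))
     refl (sumFrom1 n f) (sumFrom1 n g) (f (suc n)) (g (suc n)))

sum-+-− : ∀ n (f g h : ℕ → ℚ) →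
          sumFrom1 n (λ k → f k + g k - h k) ≡ sumFrom1 n f + sumFrom1 n g - sumFrom1 n h
sum-+-− zero    f g h = refl
sum-+-− (suc n) f g h = trans (cong (_+ (f (suc n) + g (suc n) - h (suc n))) (sum-+-− n f g h))
  (solve 6 (λ F G H x y z → (F :+ G :- H) :+ (x :+ y :- z) := (F :+ x) :+ (G :+ y) :- (H :+ z))
     refl (sumFrom1 n f) (sumFrom1 n g) (sumFrom1 n h) (f (suc n)) (g (suc n)) (h (suc n)))

sum-*ʳ : ∀ n (f : ℕ → ℚ) c → sumFrom1 n f * c ≡ sumFrom1 n (λ k → f k * c)
sum-*ʳ zero    f c = ℚ.*-zeroˡ c
sum-*ʳ (suc n) f c = trans (ℚ.*-distribʳ-+ c (sumFrom1 n f) (f (suc n))) (cong (_+ f (suc n) * c) (sum-*ʳ n f c))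

sum-front : ∀ n (f : ℕ → ℚ) → sumFrom1 (suc n) f ≡ f 1 + sumFrom1 n (f ∘ suc)
sum-front zero    f = trans (ℚ.+-identityˡ (f 1)) (sym (ℚ.+-identityʳ (f 1)))
sum-front (suc n) f = trans (cong (_+ f (suc (suc n))) (sum-front n f))
  (ℚ.+-assoc (f 1) (sumFrom1 n (f ∘ suc)) (f (suc (suc n))))

sum-reverse : ∀ n (f : ℕ → ℚ) → sumFrom1 n f ≡ sumFrom1 n (λ k → f (suc n ∸ k))
sum-reverse zero    f = refl
sum-reverse (suc n) f = trans (cong (_+ f (suc n)) (sum-reverse n f))
  (trans (ℚ.+-comm (sumFrom1 n (λ k → f (suc n ∸ k))) (f (suc n))) (sym (sum-front n (λ k → f (suc (suc n) ∸ k)))))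

telescope : (F G : ℕ → ℚ) → F 0 ≡ G 0 → (∀ n → F (suc n) - F n ≡ G (suc n) - G n) → ∀ n → F n ≡ G n
telescope F G base step zero    = base
telescope F G base step (suc n) = begin
  F (suc n)               ≡⟨ solve 2 (λ x y → x := y :+ (x :- y)) refl (F (suc n)) (F n) ⟩
  F n + (F (suc n) - F n) ≡⟨ cong₂ _+_ (telescope F G base step n) (step n) ⟩
  G n + (G (suc n) - G n) ≡⟨ solve 2 (λ x y → y :+ (x :- y) := x) refl (G (suc n)) (G n) ⟩
  G (suc n)               ∎
  where open ≡-Reasoning

[k+1]*[n+1]C[k+1]≡[n+1]*nCk : ∀ n k → suc k ℕ.* (suc n C suc k) ≡ suc n ℕ.* (n C k)
[k+1]*[n+1]C[k+1]≡[n+1]*nCk n       zero    = trans (ℕ.*-identityˡ (suc n C 1))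
                                              (trans (nC1≡n (suc n)) (sym (ℕ.*-identityʳ (suc n))))
[k+1]*[n+1]C[k+1]≡[n+1]*nCk zero    (suc k) = ℕ.*-zeroʳ (suc (suc k))
[k+1]*[n+1]C[k+1]≡[n+1]*nCk (suc n) (suc k) = begin
  suc (suc k) ℕ.* (suc (suc n) C suc (suc k))
    ≡⟨ cong (suc (suc k) ℕ.*_) (sym (nCk+nC[k+1]≡[n+1]C[k+1] (suc n) (suc k))) ⟩
  suc (suc k) ℕ.* (c ℕ.+ suc n C suc (suc k))
    ≡⟨ ℕ.*-distribˡ-+ (suc (suc k)) c (suc n C suc (suc k)) ⟩
  c ℕ.+ suc k ℕ.* c ℕ.+ suc (suc k) ℕ.* (suc n C suc (suc k))
    ≡⟨ cong₂ (λ x y → c ℕ.+ x ℕ.+ y) ([k+1]*[n+1]C[k+1]≡[n+1]*nCk n k) ([k+1]*[n+1]C[k+1]≡[n+1]*nCk n (suc k)) ⟩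
  c ℕ.+ suc n ℕ.* (n C k) ℕ.+ suc n ℕ.* (n C suc k)
    ≡⟨ ℕ.+-assoc c (suc n ℕ.* (n C k)) (suc n ℕ.* (n C suc k)) ⟩
  c ℕ.+ (suc n ℕ.* (n C k) ℕ.+ suc n ℕ.* (n C suc k))
    ≡⟨ cong (c ℕ.+_) (sym (ℕ.*-distribˡ-+ (suc n) (n C k) (n C suc k))) ⟩
  c ℕ.+ suc n ℕ.* (n C k ℕ.+ n C suc k)
    ≡⟨ cong (λ x → c ℕ.+ suc n ℕ.* x) (nCk+nC[k+1]≡[n+1]C[k+1] n k) ⟩
  suc (suc n) ℕ.* c ∎
  where
  open ≡-Reasoning
  c = suc n C suc k

-- Multiple harmonic star sums: S (a₁ ∷ … ∷ aᵣ) n = Σ_{n ≥ k₁ ≥ … ≥ kᵣ ≥ 1} 1/(k₁^a₁ ⋯ kᵣ^aᵣ).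
S : List ℕ → ℕ → ℚ
S []       n = 1ℚ
S (a ∷ as) n = sumFrom1 n (λ k → S as k * inv k ^ a)

S₁ S₂ S₃ S₄ S₁₁ S₁₁₁ S₁₁₁₁ S₁₂ S₂₁ S₁₃ S₃₁ S₂₂ S₁₁₂ S₁₂₁ S₂₁₁ : ℕ → ℚ
S₁ = S (1 ∷ [])
S₂ = S (2 ∷ [])
S₃ = S (3 ∷ [])
S₄ = S (4 ∷ [])
S₁₁ = S (1 ∷ 1 ∷ [])
S₁₁₁ = S (1 ∷ 1 ∷ 1 ∷ [])
S₁₁₁₁ = S (1 ∷ 1 ∷ 1 ∷ 1 ∷ [])
S₁₂ = S (1 ∷ 2 ∷ [])
S₂₁ = S (2 ∷ 1 ∷ [])
S₁₃ = S (1 ∷ 3 ∷ [])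
S₃₁ = S (3 ∷ 1 ∷ [])
S₂₂ = S (2 ∷ 2 ∷ [])
S₁₁₂ = S (1 ∷ 1 ∷ 2 ∷ [])
S₁₂₁ = S (1 ∷ 2 ∷ 1 ∷ [])
S₂₁₁ = S (2 ∷ 1 ∷ 1 ∷ [])

H2≡S : ∀ n m → H2 n m ≡ S (m ∷ []) n
H2≡S n m = sum-cong n λ k → trans (invPow≡inv^ (suc k) m) (sym (ℚ.*-identityˡ _))

2S₁₁≡S₁²+S₂ : ∀ n → fromℕ 2 * S₁₁ n ≡ S₁ n * S₁ n + S₂ n
2S₁₁≡S₁²+S₂ = telescope _ _ refl λ n →
  solve 4 (λ s₁₁ s₁ s₂ i → con (fromℕ 2) :* (s₁₁ :+ (s₁ :+ con 1ℚ :* i :^ 1) :* i :^ 1) :- con (fromℕ 2) :* s₁₁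
    := ((s₁ :+ con 1ℚ :* i :^ 1) :* (s₁ :+ con 1ℚ :* i :^ 1) :+ (s₂ :+ con 1ℚ :* i :^ 2)) :- (s₁ :* s₁ :+ s₂))
    refl (S₁₁ n) (S₁ n) (S₂ n) (inv (suc n))

2S₂₂≡S₂²+S₄ : ∀ n → fromℕ 2 * S₂₂ n ≡ S₂ n * S₂ n + S₄ n
2S₂₂≡S₂²+S₄ = telescope _ _ refl λ n →
  solve 4 (λ s₂₂ s₂ s₄ i → con (fromℕ 2) :* (s₂₂ :+ (s₂ :+ con 1ℚ :* i :^ 2) :* i :^ 2) :- con (fromℕ 2) :* s₂₂
    := ((s₂ :+ con 1ℚ :* i :^ 2) :* (s₂ :+ con 1ℚ :* i :^ 2) :+ (s₄ :+ con 1ℚ :* i :^ 4)) :- (s₂ :* s₂ :+ s₄))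
    refl (S₂₂ n) (S₂ n) (S₄ n) (inv (suc n))

S₃₁+S₁₃≡S₁S₃+S₄ : ∀ n → S₃₁ n + S₁₃ n ≡ S₁ n * S₃ n + S₄ n
S₃₁+S₁₃≡S₁S₃+S₄ = telescope _ _ refl λ n →
  solve 6 (λ s₃₁ s₁₃ s₁ s₃ s₄ i →
      (s₃₁ :+ (s₁ :+ con 1ℚ :* i :^ 1) :* i :^ 3 :+ (s₁₃ :+ (s₃ :+ con 1ℚ :* i :^ 3) :* i :^ 1)) :- (s₃₁ :+ s₁₃)
    := ((s₁ :+ con 1ℚ :* i :^ 1) :* (s₃ :+ con 1ℚ :* i :^ 3) :+ (s₄ :+ con 1ℚ :* i :^ 4)) :- (s₁ :* s₃ :+ s₄))
    refl (S₃₁ n) (S₁₃ n) (S₁ n) (S₃ n) (S₄ n) (inv (suc n))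

S₁S₂≡S₁₂+S₂₁-S₃ : ∀ n → S₁ n * S₂ n ≡ S₁₂ n + S₂₁ n - S₃ n
S₁S₂≡S₁₂+S₂₁-S₃ = telescope _ _ refl λ n →
  solve 6 (λ s₁ s₂ s₁₂ s₂₁ s₃ i →
      (s₁ :+ con 1ℚ :* i :^ 1) :* (s₂ :+ con 1ℚ :* i :^ 2) :- s₁ :* s₂
    := ((s₁₂ :+ (s₂ :+ con 1ℚ :* i :^ 2) :* i :^ 1) :+ (s₂₁ :+ (s₁ :+ con 1ℚ :* i :^ 1) :* i :^ 2)
          :- (s₃ :+ con 1ℚ :* i :^ 3)) :- (s₁₂ :+ s₂₁ :- s₃))
    refl (S₁ n) (S₂ n) (S₁₂ n) (S₂₁ n) (S₃ n) (inv (suc n))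

6S₁₁₁≡S₁³+3S₁S₂+2S₃ : ∀ n →
  fromℕ 6 * S₁₁₁ n ≡ S₁ n * S₁ n * S₁ n + fromℕ 3 * S₁ n * S₂ n + fromℕ 2 * S₃ n
6S₁₁₁≡S₁³+3S₁S₂+2S₃ = telescope _ _ refl λ n → let i = inv (suc n) in begin
  fromℕ 6 * S₁₁₁ (suc n) - fromℕ 6 * S₁₁₁ n
    ≡⟨ solve 3 (λ s₁₁₁ s₁₁ i → con (fromℕ 6) :* (s₁₁₁ :+ s₁₁ :* i :^ 1) :- con (fromℕ 6) :* s₁₁₁
                              := con (fromℕ 3) :* (con (fromℕ 2) :* s₁₁) :* i)
         refl (S₁₁₁ n) (S₁₁ (suc n)) i ⟩
  fromℕ 3 * (fromℕ 2 * S₁₁ (suc n)) * i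
    ≡⟨ cong (λ x → fromℕ 3 * x * i) (2S₁₁≡S₁²+S₂ (suc n)) ⟩
  fromℕ 3 * (S₁ (suc n) * S₁ (suc n) + S₂ (suc n)) * i
    ≡⟨ solve 4 (λ s₁ s₂ s₃ i → let s₁′ = s₁ :+ con 1ℚ :* i :^ 1; s₂′ = s₂ :+ con 1ℚ :* i :^ 2 in
                  con (fromℕ 3) :* (s₁′ :* s₁′ :+ s₂′) :* i
               := (s₁′ :* s₁′ :* s₁′ :+ con (fromℕ 3) :* s₁′ :* s₂′ :+ con (fromℕ 2) :* (s₃ :+ con 1ℚ :* i :^ 3))
                  :- (s₁ :* s₁ :* s₁ :+ con (fromℕ 3) :* s₁ :* s₂ :+ con (fromℕ 2) :* s₃))
         refl (S₁ n) (S₂ n) (S₃ n) i ⟩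
  _ ∎
  where open ≡-Reasoning

24S₁₁₁₁≡S₁⁴+6S₁²S₂+3S₂²+8S₁S₃+6S₄ : ∀ n →
  fromℕ 24 * S₁₁₁₁ n ≡ S₁ n * S₁ n * S₁ n * S₁ n + fromℕ 6 * S₁ n * S₁ n * S₂ n + fromℕ 3 * S₂ n * S₂ n
                       + fromℕ 8 * S₁ n * S₃ n + fromℕ 6 * S₄ n
24S₁₁₁₁≡S₁⁴+6S₁²S₂+3S₂²+8S₁S₃+6S₄ = telescope _ _ refl λ n → let i = inv (suc n) in begin
  fromℕ 24 * S₁₁₁₁ (suc n) - fromℕ 24 * S₁₁₁₁ n
    ≡⟨ solve 3 (λ s₁₁₁₁ s₁₁₁ i → con (fromℕ 24) :* (s₁₁₁₁ :+ s₁₁₁ :* i :^ 1) :- con (fromℕ 24) :* s₁₁₁₁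
                               := con (fromℕ 4) :* (con (fromℕ 6) :* s₁₁₁) :* i)
         refl (S₁₁₁₁ n) (S₁₁₁ (suc n)) i ⟩
  fromℕ 4 * (fromℕ 6 * S₁₁₁ (suc n)) * i
    ≡⟨ cong (λ x → fromℕ 4 * x * i) (6S₁₁₁≡S₁³+3S₁S₂+2S₃ (suc n)) ⟩
  fromℕ 4 * (S₁ (suc n) * S₁ (suc n) * S₁ (suc n) + fromℕ 3 * S₁ (suc n) * S₂ (suc n) + fromℕ 2 * S₃ (suc n)) * i
    ≡⟨ solve 5 (λ s₁ s₂ s₃ s₄ i →
                  let s₁′ = s₁ :+ con 1ℚ :* i :^ 1; s₂′ = s₂ :+ con 1ℚ :* i :^ 2
                      s₃′ = s₃ :+ con 1ℚ :* i :^ 3; s₄′ = s₄ :+ con 1ℚ :* i :^ 4 in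
                  con (fromℕ 4) :* (s₁′ :* s₁′ :* s₁′ :+ con (fromℕ 3) :* s₁′ :* s₂′ :+ con (fromℕ 2) :* s₃′) :* i
               := (s₁′ :* s₁′ :* s₁′ :* s₁′ :+ con (fromℕ 6) :* s₁′ :* s₁′ :* s₂′ :+ con (fromℕ 3) :* s₂′ :* s₂′
                     :+ con (fromℕ 8) :* s₁′ :* s₃′ :+ con (fromℕ 6) :* s₄′)
                  :- (s₁ :* s₁ :* s₁ :* s₁ :+ con (fromℕ 6) :* s₁ :* s₁ :* s₂ :+ con (fromℕ 3) :* s₂ :* s₂
                     :+ con (fromℕ 8) :* s₁ :* s₃ :+ con (fromℕ 6) :* s₄))
         refl (S₁ n) (S₂ n) (S₃ n) (S₄ n) i ⟩
  _ ∎
  where open ≡-Reasoning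

S₂S₁₁≡S₂₁₁+S₁₁₂+S₁₂₁-S₁₃-S₃₁ : ∀ n →
  S₂ n * S₁₁ n ≡ S₂₁₁ n + S₁₁₂ n + S₁₂₁ n - S₁₃ n - S₃₁ n
S₂S₁₁≡S₂₁₁+S₁₁₂+S₁₂₁-S₁₃-S₃₁ = telescope _ _ refl λ n → let i = inv (suc n) in begin
  S₂ (suc n) * S₁₁ (suc n) - S₂ n * S₁₁ n
    ≡⟨ solve 4 (λ s₂ s₁₁ s₁′ i →
                  (s₂ :+ con 1ℚ :* i :^ 2) :* (s₁₁ :+ s₁′ :* i :^ 1) :- s₂ :* s₁₁
               := (s₁₁ :+ s₁′ :* i :^ 1) :* i :^ 2 :+ s₁′ :* (s₂ :+ con 1ℚ :* i :^ 2) :* i :^ 1 :- s₁′ :* i :^ 3)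
         refl (S₂ n) (S₁₁ n) (S₁ (suc n)) i ⟩
  S₁₁ (suc n) * i ^ 2 + S₁ (suc n) * S₂ (suc n) * i ^ 1 - S₁ (suc n) * i ^ 3
    ≡⟨ cong (λ x → S₁₁ (suc n) * i ^ 2 + x * i ^ 1 - S₁ (suc n) * i ^ 3) (S₁S₂≡S₁₂+S₂₁-S₃ (suc n)) ⟩
  S₁₁ (suc n) * i ^ 2 + (S₁₂ (suc n) + S₂₁ (suc n) - S₃ (suc n)) * i ^ 1 - S₁ (suc n) * i ^ 3
    ≡⟨ solve 11 (λ s₂₁₁ s₁₁₂ s₁₂₁ s₁₃ s₃₁ s₁₁′ s₁₂′ s₂₁′ s₃′ s₁′ i →
                  s₁₁′ :* i :^ 2 :+ (s₁₂′ :+ s₂₁′ :- s₃′) :* i :^ 1 :- s₁′ :* i :^ 3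
               := ((s₂₁₁ :+ s₁₁′ :* i :^ 2) :+ (s₁₁₂ :+ s₁₂′ :* i :^ 1) :+ (s₁₂₁ :+ s₂₁′ :* i :^ 1)
                     :- (s₁₃ :+ s₃′ :* i :^ 1) :- (s₃₁ :+ s₁′ :* i :^ 3))
                  :- (s₂₁₁ :+ s₁₁₂ :+ s₁₂₁ :- s₁₃ :- s₃₁))
         refl (S₂₁₁ n) (S₁₁₂ n) (S₁₂₁ n) (S₁₃ n) (S₃₁ n)
              (S₁₁ (suc n)) (S₁₂ (suc n)) (S₂₁ (suc n)) (S₃ (suc n)) (S₁ (suc n)) i ⟩
  _ ∎
  where open ≡-Reasoning

ΣHH₂/k≡S₁₁₂+S₁₂₁-S₁₃ : ∀ n →
  sumFrom1 n (λ k → H k * H2 k 2 * invPow k 1) ≡ S₁₁₂ n + S₁₂₁ n - S₁₃ n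
ΣHH₂/k≡S₁₁₂+S₁₂₁-S₁₃ n = trans (sum-cong n (term ∘ suc)) (sum-+-− n _ _ _)
  where
  term : ∀ k → H k * H2 k 2 * invPow k 1 ≡ S₁₂ k * inv k ^ 1 + S₂₁ k * inv k ^ 1 - S₃ k * inv k ^ 1
  term k = begin
    H k * H2 k 2 * invPow k 1
      ≡⟨ cong₂ _*_ (cong₂ _*_ (H2≡S k 1) (H2≡S k 2)) (invPow≡inv^ k 1) ⟩
    S₁ k * S₂ k * inv k ^ 1
      ≡⟨ cong (_* inv k ^ 1) (S₁S₂≡S₁₂+S₂₁-S₃ k) ⟩
    (S₁₂ k + S₂₁ k - S₃ k) * inv k ^ 1
      ≡⟨ solve 4 (λ a b c x → (a :+ b :- c) :* x := a :* x :+ b :* x :- c :* x) refl (S₁₂ k) (S₂₁ k) (S₃ k) (inv k ^ 1) ⟩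
    S₁₂ k * inv k ^ 1 + S₂₁ k * inv k ^ 1 - S₃ k * inv k ^ 1 ∎
    where open ≡-Reasoning

ΣH²/k²≡2S₂₁₁-S₂₂ : ∀ n → sumFrom1 n (λ k → H k * H k * invPow k 2) ≡ S₂₁₁ n + S₂₁₁ n - S₂₂ n
ΣH²/k²≡2S₂₁₁-S₂₂ n = trans (sum-cong n (term ∘ suc)) (sum-+-− n _ _ _)
  where
  term : ∀ k → H k * H k * invPow k 2 ≡ S₁₁ k * inv k ^ 2 + S₁₁ k * inv k ^ 2 - S₂ k * inv k ^ 2
  term k = begin
    H k * H k * invPow k 2
      ≡⟨ cong₂ _*_ (cong₂ _*_ (H2≡S k 1) (H2≡S k 1)) (invPow≡inv^ k 2) ⟩
    (S₁ k * S₁ k) * inv k ^ 2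
      ≡⟨ solve 3 (λ a b x → a :* x := (a :+ b) :* x :- b :* x) refl (S₁ k * S₁ k) (S₂ k) (inv k ^ 2) ⟩
    (S₁ k * S₁ k + S₂ k) * inv k ^ 2 - S₂ k * inv k ^ 2
      ≡⟨ cong (λ y → y * inv k ^ 2 - S₂ k * inv k ^ 2) (sym (2S₁₁≡S₁²+S₂ k)) ⟩
    (fromℕ 2 * S₁₁ k) * inv k ^ 2 - S₂ k * inv k ^ 2
      ≡⟨ solve 3 (λ a b x → (con (fromℕ 2) :* a) :* x :- b :* x := a :* x :+ a :* x :- b :* x)
           refl (S₁₁ k) (S₂ k) (inv k ^ 2) ⟩
    S₁₁ k * inv k ^ 2 + S₁₁ k * inv k ^ 2 - S₂ k * inv k ^ 2 ∎
    where open ≡-Reasoning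

-- The binomial transform ∇ F n = Σ_{k=1}^{n} (−1)^(k−1) C(n,k) F(k); sign k = (−1)^(k+1).
sign : ℕ → ℚ
sign zero    = - 1ℚ
sign (suc k) = - sign k

∇ : (ℕ → ℚ) → ℕ → ℚ
∇ F n = sumFrom1 n (λ k → sign k * fromℕ (n C k) * F k)

Δ∇ : (ℕ → ℚ) → ℕ → ℚ
Δ∇ F n = sumFrom1 (suc n) (λ k → sign k * fromℕ (n C (k ∸ 1)) * F k)

∇-suc : ∀ F n → ∇ F (suc n) ≡ ∇ F n + Δ∇ F n
∇-suc F n = begin
  ∇ F (suc n)
    ≡⟨ sum-cong (suc n) pascal ⟩
  sumFrom1 (suc n) (λ k → ∇-term k + Δ∇-term k)
    ≡⟨ sum-+ (suc n) ∇-term Δ∇-term ⟩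
  ∇ F n + sign (suc n) * fromℕ (n C suc n) * F (suc n) + Δ∇ F n
    ≡⟨ cong (λ c → ∇ F n + sign (suc n) * fromℕ c * F (suc n) + Δ∇ F n) (k>n⇒nCk≡0 (ℕ.n<1+n n)) ⟩
  ∇ F n + sign (suc n) * 0ℚ * F (suc n) + Δ∇ F n
    ≡⟨ solve 4 (λ x s f y → x :+ s :* con 0ℚ :* f :+ y := x :+ y) refl (∇ F n) (sign (suc n)) (F (suc n)) (Δ∇ F n) ⟩
  ∇ F n + Δ∇ F n ∎
  where
  open ≡-Reasoning
  ∇-term Δ∇-term : ℕ → ℚ
  ∇-term k = sign k * fromℕ (n C k) * F k
  Δ∇-term k = sign k * fromℕ (n C (k ∸ 1)) * F k
  pascal : ∀ k → sign (suc k) * fromℕ (suc n C suc k) * F (suc k) ≡ ∇-term (suc k) + Δ∇-term (suc k)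
  pascal k = trans (cong (λ c → sign (suc k) * c * F (suc k))
                     (trans (cong fromℕ (sym (nCk+nC[k+1]≡[n+1]C[k+1] n k))) (fromℕ-+ (n C k) (n C suc k))))
    (solve 4 (λ s a b f → s :* (a :+ b) :* f := s :* b :* f :+ s :* a :* f)
       refl (sign (suc k)) (fromℕ (n C k)) (fromℕ (n C suc k)) (F (suc k)))

Δ∇-shift : ∀ F n → Δ∇ F n ≡ F 1 - ∇ (F ∘ suc) n
Δ∇-shift F n = begin
  Δ∇ F n
    ≡⟨ sum-front n _ ⟩
  1ℚ * 1ℚ * F 1 + sumFrom1 n (λ k → - sign k * fromℕ (n C k) * F (suc k))
    ≡⟨ cong (_+_ (1ℚ * 1ℚ * F 1)) (sum-cong n λ k → solve 3 (λ s c f → (:- s) :* c :* f := (s :* c :* f) :* con (- 1ℚ))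
                                                     refl (sign (suc k)) (fromℕ (n C suc k)) (F (suc (suc k)))) ⟩
  1ℚ * 1ℚ * F 1 + sumFrom1 n (λ k → sign k * fromℕ (n C k) * F (suc k) * - 1ℚ)
    ≡⟨ cong (_+_ (1ℚ * 1ℚ * F 1)) (sym (sum-*ʳ n _ (- 1ℚ))) ⟩
  1ℚ * 1ℚ * F 1 + ∇ (F ∘ suc) n * - 1ℚ
    ≡⟨ solve 2 (λ f x → con 1ℚ :* con 1ℚ :* f :+ x :* con (- 1ℚ) := f :- x) refl (F 1) (∇ (F ∘ suc) n) ⟩
  F 1 - ∇ (F ∘ suc) n ∎
  where open ≡-Reasoning

Δ∇-absorb : ∀ F G → (∀ k → F (suc k) * fromℕ (suc k) ≡ G (suc k)) → ∀ n → Δ∇ F n * fromℕ (suc n) ≡ ∇ G (suc n)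
Δ∇-absorb F G FG n = trans (sum-*ʳ (suc n) _ (fromℕ (suc n))) (sum-cong (suc n) term)
  where
  open ≡-Reasoning
  absorption : ∀ k → fromℕ (suc n) * fromℕ (n C k) ≡ fromℕ (suc k) * fromℕ (suc n C suc k)
  absorption k = trans (sym (fromℕ-* (suc n) (n C k)))
    (trans (cong fromℕ (sym ([k+1]*[n+1]C[k+1]≡[n+1]*nCk n k))) (fromℕ-* (suc k) (suc n C suc k)))
  term : ∀ k → sign (suc k) * fromℕ (n C k) * F (suc k) * fromℕ (suc n) ≡ sign (suc k) * fromℕ (suc n C suc k) * G (suc k)
  term k = begin
    sign (suc k) * fromℕ (n C k) * F (suc k) * fromℕ (suc n)
      ≡⟨ solve 4 (λ s c f m → s :* c :* f :* m := s :* (m :* c) :* f)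
           refl (sign (suc k)) (fromℕ (n C k)) (F (suc k)) (fromℕ (suc n)) ⟩
    sign (suc k) * (fromℕ (suc n) * fromℕ (n C k)) * F (suc k)
      ≡⟨ cong (λ x → sign (suc k) * x * F (suc k)) (absorption k) ⟩
    sign (suc k) * (fromℕ (suc k) * fromℕ (suc n C suc k)) * F (suc k)
      ≡⟨ solve 4 (λ s m c f → s :* (m :* c) :* f := s :* c :* (f :* m))
           refl (sign (suc k)) (fromℕ (suc k)) (fromℕ (suc n C suc k)) (F (suc k)) ⟩
    sign (suc k) * fromℕ (suc n C suc k) * (F (suc k) * fromℕ (suc k))
      ≡⟨ cong (_*_ (sign (suc k) * fromℕ (suc n C suc k))) (FG k) ⟩
    sign (suc k) * fromℕ (suc n C suc k) * G (suc k) ∎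

∇-+ : ∀ F G n → ∇ (λ k → F k + G k) n ≡ ∇ F n + ∇ G n
∇-+ F G n = trans (sum-cong n λ k → ℚ.*-distribˡ-+ (sign (suc k) * fromℕ (n C suc k)) (F (suc k)) (G (suc k)))
                  (sum-+ n _ _)

∇-cong : ∀ {F G} → (∀ k → F (suc k) ≡ G (suc k)) → ∀ n → ∇ F n ≡ ∇ G n
∇-cong F≗G n = sum-cong n λ k → cong (_*_ (sign (suc k) * fromℕ (n C suc k))) (F≗G k)

∇-one : ∀ n → ∇ (λ _ → 1ℚ) (suc n) ≡ 1ℚ
∇-one n = trans (∇-suc _ n) (trans (cong (_+_ (∇ _ n)) (Δ∇-shift _ n))
  (solve 1 (λ x → x :+ (con 1ℚ :- x) := con 1ℚ) refl (∇ (λ _ → 1ℚ) n)))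

∇-divide : ∀ F G → (∀ k → F (suc k) * fromℕ (suc k) ≡ G (suc k)) → ∀ n → ∇ F n ≡ sumFrom1 n (λ j → ∇ G j * inv j)
∇-divide F G FG zero    = refl
∇-divide F G FG (suc n) = begin
  ∇ F (suc n)                                         ≡⟨ ∇-suc F n ⟩
  ∇ F n + Δ∇ F n                                      ≡⟨ cong (_+_ (∇ F n)) (sym (*fromℕ*inv (Δ∇ F n) n)) ⟩
  ∇ F n + Δ∇ F n * fromℕ (suc n) * inv (suc n)        ≡⟨ cong₂ (λ x y → x + y * inv (suc n)) (∇-divide F G FG n) (Δ∇-absorb F G FG n) ⟩
  sumFrom1 (suc n) (λ j → ∇ G j * inv j)              ∎
  where open ≡-Reasoning

∇-partialSums : ∀ g n → ∇ (λ m → sumFrom1 m g) (suc n) ≡ Δ∇ g n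
∇-partialSums g n = begin
  ∇ G (suc n)                                  ≡⟨ ∇-suc G n ⟩
  ∇ G n + Δ∇ G n                               ≡⟨ cong (_+_ (∇ G n)) (Δ∇-shift G n) ⟩
  ∇ G n + (G 1 - ∇ (G ∘ suc) n)                ≡⟨ cong (λ x → ∇ G n + (G 1 - x)) (∇-+ G (g ∘ suc) n) ⟩
  ∇ G n + (0ℚ + g 1 - (∇ G n + ∇ (g ∘ suc) n)) ≡⟨ solve 3 (λ x y z → x :+ (con 0ℚ :+ y :- (x :+ z)) := y :- z)
                                                       refl (∇ G n) (g 1) (∇ (g ∘ suc) n) ⟩
  g 1 - ∇ (g ∘ suc) n                          ≡⟨ sym (Δ∇-shift g n) ⟩
  Δ∇ g n                                       ∎
  where
  open ≡-Reasoning
  G : ℕ → ℚ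
  G m = sumFrom1 m g

∇-*inv : ∀ (f : ℕ → ℚ) a n → ∇ (λ k → f k * inv k ^ suc a) n ≡ sumFrom1 n (λ j → ∇ (λ k → f k * inv k ^ a) j * inv j)
∇-*inv f a = ∇-divide (λ k → f k * inv k ^ suc a) (λ k → f k * inv k ^ a) λ k → *inv^-cancel (f (suc k)) a k

∇-Σ*inv : ∀ (f : ℕ → ℚ) a n → ∇ (λ m → sumFrom1 m (λ k → f k * inv k ^ suc a)) (suc n)
                     ≡ ∇ (λ k → f k * inv k ^ a) (suc n) * inv (suc n)
∇-Σ*inv f a n = begin
  ∇ (λ m → sumFrom1 m F) (suc n)           ≡⟨ ∇-partialSums F n ⟩
  Δ∇ F n                                   ≡⟨ sym (*fromℕ*inv (Δ∇ F n) n) ⟩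
  Δ∇ F n * fromℕ (suc n) * inv (suc n)     ≡⟨ cong (_* inv (suc n)) (Δ∇-absorb F _ (λ k → *inv^-cancel (f (suc k)) a k) n) ⟩
  ∇ (λ k → f k * inv k ^ a) (suc n) * inv (suc n) ∎
  where
  open ≡-Reasoning
  F : ℕ → ℚ
  F k = f k * inv k ^ suc a

∇-*inv≡S : ∀ (f : ℕ → ℚ) a bs c → (∀ j → ∇ (λ k → f k * inv k ^ a) (suc j) ≡ S bs (suc j) * inv (suc j) ^ c) →
           ∀ n → ∇ (λ k → f k * inv k ^ suc a) n ≡ S (suc c ∷ bs) n
∇-*inv≡S f a bs c hyp n = trans (∇-*inv f a n) (sum-cong n λ j →
  trans (cong (_* inv (suc j)) (hyp j))
        (solve 3 (λ s y i → s :* y :* i := s :* (i :* y)) refl (S bs (suc j)) (inv (suc j) ^ c) (inv (suc j))))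

∇-*inv≡1∷S : ∀ (f : ℕ → ℚ) a bs → (∀ j → ∇ (λ k → f k * inv k ^ a) (suc j) ≡ S bs (suc j)) →
            ∀ n → ∇ (λ k → f k * inv k ^ suc a) n ≡ S (1 ∷ bs) n
∇-*inv≡1∷S f a bs hyp = ∇-*inv≡S f a bs 0 λ j → trans (hyp j) (sym (ℚ.*-identityʳ (S bs (suc j))))

∇[1/kᵃ⁺¹] : ∀ a n → ∇ (λ k → S [] k * inv k ^ suc a) n ≡ S (replicate (suc a) 1) n
∇[1/kᵃ⁺¹] zero    = ∇-*inv≡1∷S (S []) 0 [] ∇-one
∇[1/kᵃ⁺¹] (suc a) = ∇-*inv≡1∷S (S []) (suc a) (replicate (suc a) 1) (∇[1/kᵃ⁺¹] a ∘ suc)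

∇[S₁/k³] : ∀ n → ∇ (λ k → S₁ k * inv k ^ 3) n ≡ S₁₁₂ n
∇[S₁/k³] = ∇-*inv≡1∷S S₁ 2 (1 ∷ 2 ∷ [])
             (∇-*inv≡1∷S S₁ 1 (2 ∷ []) (∇-*inv≡S S₁ 0 [] 1 ∇[S₁] ∘ suc) ∘ suc)
  where
  ∇[S₁] : ∀ j → ∇ (λ k → S₁ k * inv k ^ 0) (suc j) ≡ S [] (suc j) * inv (suc j) ^ 1
  ∇[S₁] j = begin
    ∇ (λ k → S₁ k * inv k ^ 0) (suc j) ≡⟨ ∇-cong (λ k → ℚ.*-identityʳ (S₁ (suc k))) (suc j) ⟩
    ∇ S₁ (suc j)                       ≡⟨ ∇-Σ*inv (S []) 0 j ⟩
    ∇ (λ k → S [] k * inv k ^ 0) (suc j) * inv (suc j) ≡⟨ cong (_* inv (suc j)) (∇-one j) ⟩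
    1ℚ * inv (suc j)                   ≡⟨ cong (1ℚ *_) (sym (ℚ.*-identityʳ (inv (suc j)))) ⟩
    S [] (suc j) * inv (suc j) ^ 1     ∎
    where open ≡-Reasoning

∇[S₂/k²] : ∀ n → ∇ (λ k → S₂ k * inv k ^ 2) n ≡ S₁₂₁ n
∇[S₂/k²] = ∇-*inv≡1∷S S₂ 1 (2 ∷ 1 ∷ []) (∇-*inv≡S S₂ 0 (1 ∷ []) 1 ∇[S₂] ∘ suc)
  where
  ∇[S₂] : ∀ j → ∇ (λ k → S₂ k * inv k ^ 0) (suc j) ≡ S₁ (suc j) * inv (suc j) ^ 1
  ∇[S₂] j = begin
    ∇ (λ k → S₂ k * inv k ^ 0) (suc j) ≡⟨ ∇-cong (λ k → ℚ.*-identityʳ (S₂ (suc k))) (suc j) ⟩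
    ∇ S₂ (suc j)                       ≡⟨ ∇-Σ*inv (S []) 1 j ⟩
    ∇ (λ k → S [] k * inv k ^ 1) (suc j) * inv (suc j) ≡⟨ cong (_* inv (suc j)) (∇[1/kᵃ⁺¹] 0 (suc j)) ⟩
    S₁ (suc j) * inv (suc j)           ≡⟨ cong (S₁ (suc j) *_) (sym (ℚ.*-identityʳ (inv (suc j)))) ⟩
    S₁ (suc j) * inv (suc j) ^ 1       ∎
    where open ≡-Reasoning

↧ₙ-∣ : ∀ x g D → ↧ x ℤ.* g ≡ D → ↧ₙ x ∣ ℤ.∣ D ∣
↧ₙ-∣ x g D eq = divides ℤ.∣ g ∣
  (trans (cong ℤ.∣_∣ (sym eq)) (trans (ℤ.abs-* (↧ x) g) (ℕ.*-comm (↧ₙ x) ℤ.∣ g ∣)))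

-- The prime is written p = M + 1 so that p ∸ (k + 1) reduces to M ∸ k.
module ModPrime (M : ℕ) (isPrime : Prime (suc M)) (7≤p : 7 ≤ suc M) where

  p : ℕ
  p = suc M

  2<p : 2 < p
  2<p = ℕ.<-≤-trans (from-yes (2 ℕ.<? 7)) 7≤p

  3<p : 3 < p
  3<p = ℕ.<-≤-trans (from-yes (3 ℕ.<? 7)) 7≤p

  5<p : 5 < p
  5<p = ℕ.<-≤-trans (from-yes (5 ℕ.<? 7)) 7≤p

  ∤-* : ∀ {m n} → p ∤ m → p ∤ n → p ∤ m ℕ.* n
  ∤-* {m} {n} p∤m p∤n p∣mn = [ p∤m , p∤n ] (euclidsLemma m n isPrime p∣mn)

  record Integral (x : ℚ) : Set where
    constructor integral
    field p∤↧x : p ∤ ↧ₙ x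

  open Integral

  /-integral : ∀ i n .{{_ : NonZero n}} → p ∤ n → Integral (i / n)
  /-integral i n p∤n = integral λ p∣↧ → p∤n (∣-trans p∣↧ (↧ₙ-∣ (i / n) _ (+ n) (ℚ.↧-/ i n)))

  fromℕ-integral : ∀ n → Integral (fromℕ n)
  fromℕ-integral n = /-integral (+ n) 1 (>⇒∤ (ℕ.<-≤-trans (from-yes (1 ℕ.<? 7)) 7≤p))

  inv-integral : ∀ {k} → 0 < k → k < p → Integral (inv k)
  inv-integral {suc k} _ k<p = /-integral (+ 1) (suc k ℕ.^ 1) (>⇒∤ (subst (_< p) (sym (ℕ.*-identityʳ (suc k))) k<p))

  +-integral : ∀ {x y} → Integral x → Integral y → Integral (x + y)
  +-integral {x} {y} (integral p∤x) (integral p∤y) = integral λ p∣↧ → ∤-* p∤x p∤y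
    (∣-trans p∣↧ (subst (↧ₙ (x + y) ∣_) (ℤ.abs-* (↧ x) (↧ y)) (↧ₙ-∣ (x + y) _ _ (ℚ.↧-+ x y))))

  *-integral : ∀ {x y} → Integral x → Integral y → Integral (x * y)
  *-integral {x} {y} (integral p∤x) (integral p∤y) = integral λ p∣↧ → ∤-* p∤x p∤y
    (∣-trans p∣↧ (subst (↧ₙ (x * y) ∣_) (ℤ.abs-* (↧ x) (↧ y)) (↧ₙ-∣ (x * y) _ _ (ℚ.↧-* x y))))

  -‿integral : ∀ {x} → Integral x → Integral (- x)
  -‿integral {x} (integral p∤x) = integral (subst (λ d → p ∤ ℤ.∣ d ∣) (sym (ℚ.↧-neg x)) p∤x)

  sign-integral : ∀ k → Integral (sign k)
  sign-integral zero    = -‿integral (fromℕ-integral 1)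
  sign-integral (suc k) = -‿integral (sign-integral k)

  ^-integral : ∀ {x} a → Integral x → Integral (x ^ a)
  ^-integral zero    _  = fromℕ-integral 1
  ^-integral (suc a) ix = *-integral ix (^-integral a ix)

  sum-integral : ∀ n (f : ℕ → ℚ) → (∀ k → k < n → Integral (f (suc k))) → Integral (sumFrom1 n f)
  sum-integral zero    f _  = fromℕ-integral 0
  sum-integral (suc n) f if = +-integral (sum-integral n f λ k k<n → if k (ℕ.m<n⇒m<1+n k<n)) (if n (ℕ.n<1+n n))

  S-integral : ∀ as n → n < p → Integral (S as n)
  S-integral []       n n<p = fromℕ-integral 1
  S-integral (a ∷ as) n n<p = sum-integral n _ λ k k<n →
    let 1+k<p = ℕ.≤-<-trans k<n n<p in *-integral (S-integral as (suc k) 1+k<p) (^-integral a (inv-integral (s≤s z≤n) 1+k<p))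

  Sᴹ-integral : ∀ as → Integral (S as M)
  Sᴹ-integral as = S-integral as M (ℕ.n<1+n M)

  record Vanishes (x : ℚ) : Set where
    constructor vanishes
    field
      quotient          : ℚ
      quotient-integral : Integral quotient
      x≡p*quotient      : x ≡ fromℕ p * quotient

  vanishes⇒integral : ∀ {x} → Vanishes x → Integral x
  vanishes⇒integral (vanishes q iq refl) = *-integral (fromℕ-integral p) iq

  0-vanishes : Vanishes 0ℚ
  0-vanishes = vanishes 0ℚ (fromℕ-integral 0) (sym (ℚ.*-zeroʳ (fromℕ p)))

  +-vanishes : ∀ {x y} → Vanishes x → Vanishes y → Vanishes (x + y)
  +-vanishes (vanishes q iq refl) (vanishes r ir refl) =
    vanishes (q + r) (+-integral iq ir) (sym (ℚ.*-distribˡ-+ (fromℕ p) q r))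

  *-vanishes : ∀ {c x} → Integral c → Vanishes x → Vanishes (c * x)
  *-vanishes {c} ic (vanishes q iq refl) = vanishes (c * q) (*-integral ic iq)
    (solve 3 (λ c p q → c :* (p :* q) := p :* (c :* q)) refl c (fromℕ p) q)

  sum-vanishes : ∀ n (f : ℕ → ℚ) → (∀ k → k < n → Vanishes (f (suc k))) → Vanishes (sumFrom1 n f)
  sum-vanishes zero    f _  = 0-vanishes
  sum-vanishes (suc n) f vf = +-vanishes (sum-vanishes n f λ k k<n → vf k (ℕ.m<n⇒m<1+n k<n)) (vf n (ℕ.n<1+n n))

  −-vanishes : ∀ {x y} → Vanishes x → Vanishes y → Vanishes (x - y)
  −-vanishes {x} {y} vx vy = subst Vanishes (solve 2 (λ x y → x :+ con (- 1ℚ) :* y := x :- y) refl x y)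
    (+-vanishes vx (*-vanishes (-‿integral (fromℕ-integral 1)) vy))

  vanishes-cancel : ∀ {m x} → 0 < m → m < p → Vanishes (fromℕ m * x) → Vanishes x
  vanishes-cancel {suc m} {x} _ m<p vmx = subst Vanishes eq (*-vanishes (inv-integral (s≤s z≤n) m<p) vmx)
    where
    eq : inv (suc m) * (fromℕ (suc m) * x) ≡ x
    eq = trans (solve 3 (λ i m x → i :* (m :* x) := m :* i :* x) refl (inv (suc m)) (fromℕ (suc m)) x)
               (trans (cong (_* x) (fromℕ*inv m)) (ℚ.*-identityˡ x))

  vanishing⇒≡[modℚ] : ∀ {x y} r → Integral r → Vanishes x → Vanishes y → x ≡ r * y [modℚ p ]
  vanishing⇒≡[modℚ] r ir vx vy =
    p∤↧x (vanishes⇒integral vx) , p∤↧x (*-integral ir (vanishes⇒integral vy)) ,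
    quotient , p∤↧x quotient-integral , x≡p*quotient
    where open Vanishes (−-vanishes vx (*-vanishes ir vy))

  p∣pC[k+1] : ∀ {k} → k < M → p ∣ p C suc k
  p∣pC[k+1] {k} k<M with euclidsLemma (suc k) (p C suc k) isPrime
                           (divides (M C k) (trans ([k+1]*[n+1]C[k+1]≡[n+1]*nCk M k) (ℕ.*-comm p (M C k))))
  ... | inj₁ p∣k+1 = ⊥-elim (>⇒∤ (s≤s k<M) p∣k+1)
  ... | inj₂ p∣pC  = p∣pC

  -- (−1)^k C(p−1,k) ≡ 1, by induction on k since C(p−1,k) + C(p−1,k+1) = C(p,k+1) ≡ 0.
  sign*C+1-vanishes : ∀ k → k ≤ M → Vanishes (sign k * fromℕ (M C k) + 1ℚ)
  sign*C+1-vanishes zero    _    = 0-vanishes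
  sign*C+1-vanishes (suc k) k<M with p∣pC[k+1] k<M
  ... | divides q pC≡q*p = subst Vanishes eq
    (+-vanishes (sign*C+1-vanishes k (ℕ.<⇒≤ k<M))
                (vanishes (- sign k * fromℕ q) (*-integral (sign-integral (suc k)) (fromℕ-integral q)) refl))
    where
    open ≡-Reasoning
    pascal : fromℕ (M C k) + fromℕ (M C suc k) ≡ fromℕ q * fromℕ p
    pascal = trans (sym (fromℕ-+ (M C k) (M C suc k)))
                   (trans (cong fromℕ (trans (nCk+nC[k+1]≡[n+1]C[k+1] M k) pC≡q*p)) (fromℕ-* q p))
    eq : sign k * fromℕ (M C k) + 1ℚ + fromℕ p * (- sign k * fromℕ q) ≡ - sign k * fromℕ (M C suc k) + 1ℚ
    eq = begin
      sign k * fromℕ (M C k) + 1ℚ + fromℕ p * (- sign k * fromℕ q)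
        ≡⟨ solve 5 (λ s a b P Q → s :* a :+ con 1ℚ :+ P :* (:- s :* Q) := :- s :* (Q :* P :- a) :+ con 1ℚ)
             refl (sign k) (fromℕ (M C k)) (fromℕ (M C suc k)) (fromℕ p) (fromℕ q) ⟩
      - sign k * (fromℕ q * fromℕ p - fromℕ (M C k)) + 1ℚ
        ≡⟨ cong (λ x → - sign k * (x - fromℕ (M C k)) + 1ℚ) (sym pascal) ⟩
      - sign k * (fromℕ (M C k) + fromℕ (M C suc k) - fromℕ (M C k)) + 1ℚ
        ≡⟨ solve 3 (λ s a b → :- s :* (a :+ b :- a) :+ con 1ℚ := :- s :* b :+ con 1ℚ)
             refl (sign k) (fromℕ (M C k)) (fromℕ (M C suc k)) ⟩
      - sign k * fromℕ (M C suc k) + 1ℚ ∎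

  ∇+Σ-vanishes : ∀ (f : ℕ → ℚ) → (∀ k → k < M → Integral (f (suc k))) → Vanishes (∇ f M + sumFrom1 M f)
  ∇+Σ-vanishes f if = subst Vanishes (trans (sum-cong M term) (sum-+ M _ f))
    (sum-vanishes M (λ k → f k * (sign k * fromℕ (M C k) + 1ℚ)) λ k k<M → *-vanishes (if k k<M) (sign*C+1-vanishes (suc k) k<M))
    where
    term : ∀ k → f (suc k) * (sign (suc k) * fromℕ (M C suc k) + 1ℚ) ≡ sign (suc k) * fromℕ (M C suc k) * f (suc k) + f (suc k)
    term k = solve 3 (λ f s c → f :* (s :* c :+ con 1ℚ) := s :* c :* f :+ f) refl (f (suc k)) (sign (suc k)) (fromℕ (M C suc k))

  ∇+S-vanishes : ∀ as a → Vanishes (∇ (λ k → S as k * inv k ^ a) M + S (a ∷ as) M)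
  ∇+S-vanishes as a = ∇+Σ-vanishes _ λ k k<M →
    *-integral (S-integral as (suc k) (s≤s k<M)) (^-integral a (inv-integral (s≤s z≤n) (s≤s k<M)))

  inv-reflect : ∀ {k} → 0 < k → k < p → Vanishes (inv (p ∸ k) + inv k)
  inv-reflect {k} 0<k k<p = vanishes (inv k * inv (p ∸ k))
    (*-integral (inv-integral 0<k k<p) (inv-integral (ℕ.m<n⇒0<n∸m k<p) (ℕ.∸-monoʳ-< 0<k (ℕ.<⇒≤ k<p))))
    (begin
      b + a
        ≡⟨ solve 2 (λ a b → b :+ a := b :* con 1ℚ :+ a :* con 1ℚ) refl a b ⟩
      b * 1ℚ + a * 1ℚ
        ≡⟨ cong₂ (λ x y → b * x + a * y) (sym (fromℕ*inv′ 0<k)) (sym (fromℕ*inv′ (ℕ.m<n⇒0<n∸m k<p))) ⟩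
      b * (fromℕ k * a) + a * (fromℕ (p ∸ k) * b)
        ≡⟨ solve 4 (λ a b m n → b :* (m :* a) :+ a :* (n :* b) := (n :+ m) :* (a :* b)) refl a b (fromℕ k) (fromℕ (p ∸ k)) ⟩
      (fromℕ (p ∸ k) + fromℕ k) * (a * b)
        ≡⟨ cong (_* (a * b)) (trans (sym (fromℕ-+ (p ∸ k) k)) (cong fromℕ (ℕ.m∸n+n≡m (ℕ.<⇒≤ k<p)))) ⟩
      fromℕ p * (a * b) ∎)
    where
    open ≡-Reasoning
    a = inv k
    b = inv (p ∸ k)

  S₁-vanishes : Vanishes (S₁ M)
  S₁-vanishes = vanishes-cancel (s≤s z≤n) 2<p (subst Vanishes (sym eq)
    (sum-vanishes M _ λ k k<M → inv-reflect (s≤s z≤n) (s≤s k<M)))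
    where
    open ≡-Reasoning
    t : ℕ → ℚ
    t k = 1ℚ * inv k ^ 1
    eq : fromℕ 2 * S₁ M ≡ sumFrom1 M (λ k → inv (p ∸ k) + inv k)
    eq = begin
      fromℕ 2 * S₁ M                           ≡⟨ solve 1 (λ x → con (fromℕ 2) :* x := x :+ x) refl (S₁ M) ⟩
      S₁ M + S₁ M                              ≡⟨ cong (_+ S₁ M) (sum-reverse M t) ⟩
      sumFrom1 M (λ k → t (p ∸ k)) + S₁ M      ≡⟨ sym (sum-+ M (λ k → t (p ∸ k)) t) ⟩
      sumFrom1 M (λ k → t (p ∸ k) + t k)       ≡⟨ sum-cong M (λ k → solve 2 (λ b a → con 1ℚ :* b :^ 1 :+ con 1ℚ :* a :^ 1 := b :+ a)
                                                                      refl (inv (p ∸ suc k)) (inv (suc k))) ⟩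
      sumFrom1 M (λ k → inv (p ∸ k) + inv k)   ∎

  S₁-reflect : ∀ m → m ≤ M → Vanishes (S₁ (M ∸ m) - S₁ m)
  S₁-reflect zero    _   = subst Vanishes (sym (ℚ.+-identityʳ (S₁ M))) S₁-vanishes
  S₁-reflect (suc m) m<M = subst Vanishes eq
    (+-vanishes (S₁-reflect m (ℕ.<⇒≤ m<M)) (*-vanishes (-‿integral (fromℕ-integral 1)) (inv-reflect (s≤s z≤n) (s≤s m<M))))
    where
    open ≡-Reasoning
    M∸m≡1+M∸[1+m] : M ∸ m ≡ suc (M ∸ suc m)
    M∸m≡1+M∸[1+m] = ℕ.+-∸-assoc 1 m<M
    unfold : S₁ (M ∸ m) ≡ S₁ (M ∸ suc m) + 1ℚ * inv (M ∸ m) ^ 1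
    unfold = trans (cong S₁ M∸m≡1+M∸[1+m]) (cong (λ x → S₁ (M ∸ suc m) + 1ℚ * inv x ^ 1) (sym M∸m≡1+M∸[1+m]))
    eq : S₁ (M ∸ m) - S₁ m + - 1ℚ * (inv (M ∸ m) + inv (suc m)) ≡ S₁ (M ∸ suc m) - S₁ (suc m)
    eq = begin
      S₁ (M ∸ m) - S₁ m + - 1ℚ * (inv (M ∸ m) + inv (suc m))
        ≡⟨ cong (λ x → x - S₁ m + - 1ℚ * (inv (M ∸ m) + inv (suc m))) unfold ⟩
      S₁ (M ∸ suc m) + 1ℚ * inv (M ∸ m) ^ 1 - S₁ m + - 1ℚ * (inv (M ∸ m) + inv (suc m))
        ≡⟨ solve 4 (λ x b y a → x :+ con 1ℚ :* b :^ 1 :- y :+ con (- 1ℚ) :* (b :+ a) := x :- (y :+ con 1ℚ :* a :^ 1))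
             refl (S₁ (M ∸ suc m)) (inv (M ∸ m)) (S₁ m) (inv (suc m)) ⟩
      S₁ (M ∸ suc m) - S₁ (suc m) ∎

  2S₃₁-S₄-vanishes : Vanishes (fromℕ 2 * S₃₁ M - S₄ M)
  2S₃₁-S₄-vanishes = subst Vanishes (sym eq) (sum-vanishes M _ term)
    where
    open ≡-Reasoning
    t u : ℕ → ℚ
    t k = S₁ k * inv k ^ 3
    u k = 1ℚ * inv k ^ 4
    eq : fromℕ 2 * S₃₁ M - S₄ M ≡ sumFrom1 M (λ k → t (p ∸ k) + t k - u k)
    eq = begin
      fromℕ 2 * S₃₁ M - S₄ M                          ≡⟨ solve 2 (λ x y → con (fromℕ 2) :* x :- y := x :+ x :- y) refl (S₃₁ M) (S₄ M) ⟩
      S₃₁ M + S₃₁ M - S₄ M                            ≡⟨ cong (λ x → x + S₃₁ M - S₄ M) (sum-reverse M t) ⟩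
      sumFrom1 M (λ k → t (p ∸ k)) + S₃₁ M - S₄ M     ≡⟨ sym (sum-+-− M (λ k → t (p ∸ k)) t u) ⟩
      sumFrom1 M (λ k → t (p ∸ k) + t k - u k)        ∎
    term : ∀ j → j < M → Vanishes (t (M ∸ j) + t (suc j) - u (suc j))
    term j j<M = subst Vanishes eq′
      (+-vanishes (*-vanishes (^-integral 3 ib) (S₁-reflect j (ℕ.<⇒≤ j<M)))
                  (*-vanishes (*-integral (S-integral (1 ∷ []) j (ℕ.<-trans j<M (ℕ.n<1+n M)))
                                          (+-integral (+-integral (^-integral 2 ib) (-‿integral (*-integral ia ib))) (^-integral 2 ia)))
                              (inv-reflect (s≤s z≤n) (s≤s j<M))))
      where
      a = inv (suc j)
      b = inv (M ∸ j)
      ia = inv-integral (s≤s z≤n) (s≤s j<M)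
      ib = inv-integral (ℕ.m<n⇒0<n∸m j<M) (s≤s (ℕ.m∸n≤m M j))
      eq′ : b ^ 3 * (S₁ (M ∸ j) - S₁ j) + S₁ j * (b ^ 2 - a * b + a ^ 2) * (b + a) ≡ t (M ∸ j) + t (suc j) - u (suc j)
      eq′ = solve 4 (λ x y a b → b :^ 3 :* (x :- y) :+ y :* (b :^ 2 :- a :* b :+ a :^ 2) :* (b :+ a)
                               := x :* b :^ 3 :+ (y :+ con 1ℚ :* a :^ 1) :* a :^ 3 :- con 1ℚ :* a :^ 4)
              refl (S₁ (M ∸ j)) (S₁ j) a b

  S₁₁+S₂-vanishes : Vanishes (S₁₁ M + S₂ M)
  S₁₁+S₂-vanishes = subst Vanishes (cong (_+ S₂ M) (∇[1/kᵃ⁺¹] 1 M)) (∇+S-vanishes [] 2)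

  S₁₁₁₁+S₄-vanishes : Vanishes (S₁₁₁₁ M + S₄ M)
  S₁₁₁₁+S₄-vanishes = subst Vanishes (cong (_+ S₄ M) (∇[1/kᵃ⁺¹] 3 M)) (∇+S-vanishes [] 4)

  S₁₁₂+S₃₁-vanishes : Vanishes (S₁₁₂ M + S₃₁ M)
  S₁₁₂+S₃₁-vanishes = subst Vanishes (cong (_+ S₃₁ M) (∇[S₁/k³] M)) (∇+S-vanishes (1 ∷ []) 3)

  S₁₂₁+S₂₂-vanishes : Vanishes (S₁₂₁ M + S₂₂ M)
  S₁₂₁+S₂₂-vanishes = subst Vanishes (cong (_+ S₂₂ M) (∇[S₂/k²] M)) (∇+S-vanishes (2 ∷ []) 2)

  S₂-vanishes : Vanishes (S₂ M)
  S₂-vanishes = vanishes-cancel (s≤s z≤n) 3<p (subst Vanishes eq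
    (−-vanishes (*-vanishes (fromℕ-integral 2) S₁₁+S₂-vanishes) (*-vanishes (Sᴹ-integral (1 ∷ [])) S₁-vanishes)))
    where
    open ≡-Reasoning
    eq : fromℕ 2 * (S₁₁ M + S₂ M) - S₁ M * S₁ M ≡ fromℕ 3 * S₂ M
    eq = begin
      fromℕ 2 * (S₁₁ M + S₂ M) - S₁ M * S₁ M
        ≡⟨ solve 3 (λ x y z → con (fromℕ 2) :* (x :+ y) :- z :* z := con (fromℕ 2) :* x :+ con (fromℕ 2) :* y :- z :* z)
             refl (S₁₁ M) (S₂ M) (S₁ M) ⟩
      fromℕ 2 * S₁₁ M + fromℕ 2 * S₂ M - S₁ M * S₁ M
        ≡⟨ cong (λ x → x + fromℕ 2 * S₂ M - S₁ M * S₁ M) (2S₁₁≡S₁²+S₂ M) ⟩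
      S₁ M * S₁ M + S₂ M + fromℕ 2 * S₂ M - S₁ M * S₁ M
        ≡⟨ solve 2 (λ y z → z :* z :+ y :+ con (fromℕ 2) :* y :- z :* z := con (fromℕ 3) :* y) refl (S₂ M) (S₁ M) ⟩
      fromℕ 3 * S₂ M ∎

  S₄-vanishes : Vanishes (S₄ M)
  S₄-vanishes = vanishes-cancel (s≤s z≤n) 5<p (vanishes-cancel (s≤s z≤n) 3<p (vanishes-cancel (s≤s z≤n) 2<p
    (subst Vanishes eq (−-vanishes (−-vanishes (*-vanishes (fromℕ-integral 24) S₁₁₁₁+S₄-vanishes)
                                                (*-vanishes iX S₁-vanishes))
                                   (*-vanishes (*-integral (fromℕ-integral 3) i₂) S₂-vanishes)))))
    where
    open ≡-Reasoning
    s₁ = S₁ M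
    s₂ = S₂ M
    s₃ = S₃ M
    s₄ = S₄ M
    i₁ = Sᴹ-integral (1 ∷ [])
    i₂ = Sᴹ-integral (2 ∷ [])
    X = s₁ * s₁ * s₁ + fromℕ 6 * s₁ * s₂ + fromℕ 8 * s₃
    iX : Integral X
    iX = +-integral (+-integral (*-integral (*-integral i₁ i₁) i₁) (*-integral (*-integral (fromℕ-integral 6) i₁) i₂))
                    (*-integral (fromℕ-integral 8) (Sᴹ-integral (3 ∷ [])))
    eq : fromℕ 24 * (S₁₁₁₁ M + s₄) - X * s₁ - fromℕ 3 * s₂ * s₂ ≡ fromℕ 2 * (fromℕ 3 * (fromℕ 5 * s₄))
    eq = begin
      fromℕ 24 * (S₁₁₁₁ M + s₄) - X * s₁ - fromℕ 3 * s₂ * s₂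
        ≡⟨ solve 5 (λ a s₂ s₄ x y → con (fromℕ 24) :* (a :+ s₄) :- x :- con (fromℕ 3) :* s₂ :* s₂
                                  := con (fromℕ 24) :* a :+ (con (fromℕ 24) :* s₄ :- x :- con (fromℕ 3) :* s₂ :* s₂))
             refl (S₁₁₁₁ M) s₂ s₄ (X * s₁) s₁ ⟩
      fromℕ 24 * S₁₁₁₁ M + (fromℕ 24 * s₄ - X * s₁ - fromℕ 3 * s₂ * s₂)
        ≡⟨ cong (_+ (fromℕ 24 * s₄ - X * s₁ - fromℕ 3 * s₂ * s₂)) (24S₁₁₁₁≡S₁⁴+6S₁²S₂+3S₂²+8S₁S₃+6S₄ M) ⟩
      s₁ * s₁ * s₁ * s₁ + fromℕ 6 * s₁ * s₁ * s₂ + fromℕ 3 * s₂ * s₂ + fromℕ 8 * s₁ * s₃ + fromℕ 6 * s₄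
        + (fromℕ 24 * s₄ - X * s₁ - fromℕ 3 * s₂ * s₂)
        ≡⟨ solve 4 (λ s₁ s₂ s₃ s₄ →
               s₁ :* s₁ :* s₁ :* s₁ :+ con (fromℕ 6) :* s₁ :* s₁ :* s₂ :+ con (fromℕ 3) :* s₂ :* s₂
                 :+ con (fromℕ 8) :* s₁ :* s₃ :+ con (fromℕ 6) :* s₄
                 :+ (con (fromℕ 24) :* s₄ :- (s₁ :* s₁ :* s₁ :+ con (fromℕ 6) :* s₁ :* s₂ :+ con (fromℕ 8) :* s₃) :* s₁
                     :- con (fromℕ 3) :* s₂ :* s₂)
             := con (fromℕ 2) :* (con (fromℕ 3) :* (con (fromℕ 5) :* s₄)))
             refl s₁ s₂ s₃ s₄ ⟩
      fromℕ 2 * (fromℕ 3 * (fromℕ 5 * s₄)) ∎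

  S₃₁-vanishes : Vanishes (S₃₁ M)
  S₃₁-vanishes = vanishes-cancel (s≤s z≤n) 2<p (subst Vanishes
    (solve 2 (λ x y → con (fromℕ 2) :* x :- y :+ y := con (fromℕ 2) :* x) refl (S₃₁ M) (S₄ M))
    (+-vanishes 2S₃₁-S₄-vanishes S₄-vanishes))

  S₁₃-vanishes : Vanishes (S₁₃ M)
  S₁₃-vanishes = subst Vanishes eq
    (−-vanishes (+-vanishes (*-vanishes (Sᴹ-integral (3 ∷ [])) S₁-vanishes) S₄-vanishes) S₃₁-vanishes)
    where
    eq : S₃ M * S₁ M + S₄ M - S₃₁ M ≡ S₁₃ M
    eq = trans (cong (λ x → x + S₄ M - S₃₁ M) (ℚ.*-comm (S₃ M) (S₁ M)))
      (trans (cong (_- S₃₁ M) (sym (S₃₁+S₁₃≡S₁S₃+S₄ M)))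
             (solve 2 (λ x y → x :+ y :- x := y) refl (S₃₁ M) (S₁₃ M)))

  S₂₂-vanishes : Vanishes (S₂₂ M)
  S₂₂-vanishes = vanishes-cancel (s≤s z≤n) 2<p (subst Vanishes (sym (2S₂₂≡S₂²+S₄ M))
    (+-vanishes (*-vanishes (Sᴹ-integral (2 ∷ [])) S₂-vanishes) S₄-vanishes))

  S₁₁₂-vanishes : Vanishes (S₁₁₂ M)
  S₁₁₂-vanishes = subst Vanishes (solve 2 (λ x y → x :+ y :- y := x) refl (S₁₁₂ M) (S₃₁ M))
    (−-vanishes S₁₁₂+S₃₁-vanishes S₃₁-vanishes)

  S₁₂₁-vanishes : Vanishes (S₁₂₁ M)
  S₁₂₁-vanishes = subst Vanishes (solve 2 (λ x y → x :+ y :- y := x) refl (S₁₂₁ M) (S₂₂ M))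
    (−-vanishes S₁₂₁+S₂₂-vanishes S₂₂-vanishes)

  S₂₁₁-vanishes : Vanishes (S₂₁₁ M)
  S₂₁₁-vanishes = subst Vanishes eq
    (+-vanishes (−-vanishes (−-vanishes (*-vanishes (Sᴹ-integral (1 ∷ 1 ∷ [])) S₂-vanishes) S₁₁₂-vanishes)
                            S₁₂₁-vanishes)
                (+-vanishes S₁₃-vanishes S₃₁-vanishes))
    where
    eq : S₁₁ M * S₂ M - S₁₁₂ M - S₁₂₁ M + (S₁₃ M + S₃₁ M) ≡ S₂₁₁ M
    eq = trans (cong (λ x → x - S₁₁₂ M - S₁₂₁ M + (S₁₃ M + S₃₁ M))
                     (trans (ℚ.*-comm (S₁₁ M) (S₂ M)) (S₂S₁₁≡S₂₁₁+S₁₁₂+S₁₂₁-S₁₃-S₃₁ M)))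
      (solve 5 (λ a b c d e → a :+ b :+ c :- d :- e :- b :- c :+ (d :+ e) := a)
         refl (S₂₁₁ M) (S₁₁₂ M) (S₁₂₁ M) (S₁₃ M) (S₃₁ M))

  ΣHH₂/k-vanishes : Vanishes (sumFrom1 M (λ k → H k * H2 k 2 * invPow k 1))
  ΣHH₂/k-vanishes = subst Vanishes (sym (ΣHH₂/k≡S₁₁₂+S₁₂₁-S₁₃ M))
    (−-vanishes (+-vanishes S₁₁₂-vanishes S₁₂₁-vanishes) S₁₃-vanishes)

  ΣH²/k²-vanishes : Vanishes (sumFrom1 M (λ k → H k * H k * invPow k 2))
  ΣH²/k²-vanishes = subst Vanishes (sym (ΣH²/k²≡2S₂₁₁-S₂₂ M))
    (−-vanishes (+-vanishes S₂₁₁-vanishes S₂₁₁-vanishes) S₂₂-vanishes)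

lemma2p6 : (p : ℕ) → Prime p → 7 ≤ p →
    sumFrom1 (p ∸ 1) (λ k → H k * H2 k 2 * invPow k 1)
      ≡ (-[1+ 2 ] / 2) * sumFrom1 (p ∸ 1) (λ k → H k * H k * invPow k 2) [modℚ p ]
lemma2p6 (suc M) isPrime 7≤p =
  vanishing⇒≡[modℚ] (-[1+ 2 ] / 2) (/-integral -[1+ 2 ] 2 (>⇒∤ 2<p)) ΣHH₂/k-vanishes ΣH²/k²-vanishes
  where open ModPrime M isPrime 7≤p
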